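{- The only squarefree positive integers that are bi-unitary harmonic are $1$ and $6$.
   Context: A divisor $d$ of $n$ is a unitary divisor if $\gcd(d,n/d)=1$; a divisor $d$ of $n$ is a bi-unitary divisor if the greatest common unitary divisor of $d$ and $n/d$ is $1$. $\sigma^{**}(n)$ denotes the sum and $d^{**}(n)$ the number of bi-unitary divisors of $n$. $n$ is bi-unitary harmonic if $\sigma^{**}(n)\mid n\,d^{**}(n)$. -}

module Defs where

open import Data.Nat using (ℕ; zero; suc; _+_; _*_; _≤_; _/_)
open import Data.Nat.Properties using (_≟_)
open import Data.Nat.Divisibility using (_∣_; _∣?_)
open import Data.Nat.GCD using (gcd)
open import Data.List using (List; []; _∷_; filter; map; length; foldr; upTo)
open import Data.Nat.ListAction using (sum)
open import Data.Product using (_×_)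
open import Relation.Nullary using (Dec)
open import Relation.Nullary.Decidable using (_×-dec_)
open import Relation.Binary.PropositionalEquality using (_≡_)

-- n / d, with the (irrelevant) convention n / 0 = 0
quot : ℕ → ℕ → ℕ
quot n zero    = zero
quot n (suc k) = n / suc k

range1 : ℕ → List ℕ
range1 n = map suc (upTo n)

IsUnitaryDivisor : ℕ → ℕ → Set
IsUnitaryDivisor d n = d ∣ n × gcd d (quot n d) ≡ 1

isUnitaryDivisor? : ∀ d n → Dec (IsUnitaryDivisor d n)
isUnitaryDivisor? d n = (d ∣? n) ×-dec (gcd d (quot n d) ≟ 1)

commonUnitaryDivisors : ℕ → ℕ → List ℕ
commonUnitaryDivisors a b =
  filter (λ d → isUnitaryDivisor? d a ×-dec isUnitaryDivisor? d b) (range1 a)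

maxList : List ℕ → ℕ
maxList = foldr Data.Nat._⊔_ 0

gcud : ℕ → ℕ → ℕ
gcud a b = maxList (commonUnitaryDivisors a b)

IsBiUnitaryDivisor : ℕ → ℕ → Set
IsBiUnitaryDivisor d n = d ∣ n × gcud d (quot n d) ≡ 1

isBiUnitaryDivisor? : ∀ d n → Dec (IsBiUnitaryDivisor d n)
isBiUnitaryDivisor? d n = (d ∣? n) ×-dec (gcud d (quot n d) ≟ 1)

biUnitaryDivisors : ℕ → List ℕ
biUnitaryDivisors n = filter (λ d → isBiUnitaryDivisor? d n) (range1 n)

σ** : ℕ → ℕ
σ** n = sum (biUnitaryDivisors n)

d** : ℕ → ℕ
d** n = length (biUnitaryDivisors n)

BiUnitaryHarmonic : ℕ → Set
BiUnitaryHarmonic n = σ** n ∣ n * d** n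

Squarefree : ℕ → Set
Squarefree n = ∀ m → m * m ∣ n → m ≡ 1

module Submission where

-- If n is squarefree then gcd(d, n/d) = 1 for every divisor d, so every
-- divisor is bi-unitary: σ**(n) = σ(n) and d**(n) = τ(n) are the classical
-- divisor sum and divisor count, and the condition reads σ(n) ∣ n·τ(n).
-- At an irreducible p ∤ m we have σ(pm) = (p+1)·σ(m) and τ(pm) = 2·τ(m).
-- For odd squarefree m each factor p+1 is even, so τ(m) ∣ σ(m); hence if
-- n = q·m with m odd, σ(n) ∣ N·τ(n) forces (q+1) ∣ 2N.  With q the least
-- factor of n:
--   * n odd:  (q+1)/2 is a divisor of n in [2, q), impossible;
--   * n = 2m: 3 ∣ m, and writing n = 6m' the condition descends to
--     σ(m') ∣ 2m'·τ(m'); for m' > 1 its least factor q' ∉ {2, 3} gives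
--     (q'+1) ∣ 4m', and (q'+1)/2 or (q'+1)/4 is a divisor of m' in [2, q').
-- Order of the file: sums over 1..N, divisor sums at a new prime, the
-- squarefree reduction of σ** and d**, least factors with an induction
-- principle for squarefree numbers, τ ∣ σ for odd m, the classification.

open import Defs
open import Data.Nat
open import Data.Nat.Properties
open import Data.Nat.Divisibility
open import Data.Nat.DivMod using (m*n/n≡m)
open import Data.Nat.GCD using (gcd; gcd[m,n]∣m; gcd[m,n]∣n; gcd-greatest; gcd-zeroˡ)
open import Data.Nat.Coprimality using (Coprime; coprime-divisor)
open import Data.Nat.Primality using (Irreducible; irreducible[2]; irreducible?; ¬irreducible[0])
open import Data.Nat.Induction using (<-rec)
open import Data.Nat.Solver using (module +-*-Solver)
open import Data.Nat.ListAction using (sum)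
open import Data.Nat.ListAction.Properties using (sum-++)
open import Data.List using (List; []; _∷_; filter; map; length; upTo; _++_; [_])
open import Data.List.Properties using (map-id; map-++; upTo-∷ʳ)
open import Data.List.Relation.Unary.All using (All; []; _∷_)
import Data.List.Relation.Unary.All as All
open import Data.List.Relation.Unary.All.Properties using (all-filter)
open import Data.List.Relation.Unary.Any using (here; there)
open import Data.List.Membership.Propositional using (_∈_)
open import Data.List.Membership.Propositional.Properties using (∈-filter⁺)
open import Data.Product using (_×_; _,_; proj₁; ∃)
open import Data.Sum using (_⊎_; inj₁; inj₂)
open import Data.Empty using (⊥-elim)
open import Relation.Nullary using (Dec; yes; no; ¬_)
open import Relation.Nullary.Decidable using (_×-dec_; from-yes; from-no)
open import Relation.Binary.PropositionalEquality hiding ([_])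
open import Function.Bundles using (_⇔_; mk⇔)
open ≡-Reasoning
open +-*-Solver using (solve; _:+_; _:*_; con; _:=_)

sumTo : (ℕ → ℕ) → ℕ → ℕ
sumTo f zero    = 0
sumTo f (suc N) = sumTo f N + f (suc N)

sumTo-cong : ∀ {f g} → (∀ d → f (suc d) ≡ g (suc d)) → ∀ N → sumTo f N ≡ sumTo g N
sumTo-cong f≗g zero    = refl
sumTo-cong f≗g (suc N) = cong₂ _+_ (sumTo-cong f≗g N) (f≗g N)

sumTo-+ : ∀ f g N → sumTo (λ d → f d + g d) N ≡ sumTo f N + sumTo g N
sumTo-+ f g zero    = refl
sumTo-+ f g (suc N) = begin
  sumTo (λ d → f d + g d) N + (f (suc N) + g (suc N))
    ≡⟨ cong (_+ (f (suc N) + g (suc N))) (sumTo-+ f g N) ⟩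
  (sumTo f N + sumTo g N) + (f (suc N) + g (suc N))
    ≡⟨ interchange (sumTo f N) (sumTo g N) (f (suc N)) (g (suc N)) ⟩
  (sumTo f N + f (suc N)) + (sumTo g N + g (suc N)) ∎
  where
  interchange : ∀ a b c d → (a + b) + (c + d) ≡ (a + c) + (b + d)
  interchange = solve 4 (λ a b c d → (a :+ b) :+ (c :+ d) := (a :+ c) :+ (b :+ d)) refl

sumTo-*ˡ : ∀ c f N → sumTo (λ d → c * f d) N ≡ c * sumTo f N
sumTo-*ˡ c f zero    = sym (*-zeroʳ c)
sumTo-*ˡ c f (suc N) = trans (cong (_+ c * f (suc N)) (sumTo-*ˡ c f N))
                             (sym (*-distribˡ-+ c (sumTo f N) (f (suc N))))

sumTo-stable : ∀ f n k → (∀ d → n < d → f d ≡ 0) → sumTo f (n + k) ≡ sumTo f n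
sumTo-stable f n zero    _         = cong (sumTo f) (+-identityʳ n)
sumTo-stable f n (suc k) vanishing = begin
  sumTo f (n + suc k)               ≡⟨ cong (sumTo f) (+-suc n k) ⟩
  sumTo f (n + k) + f (suc (n + k)) ≡⟨ cong₂ _+_ (sumTo-stable f n k vanishing)
                                                  (vanishing _ (s≤s (m≤m+n n k))) ⟩
  sumTo f n + 0                     ≡⟨ +-identityʳ _ ⟩
  sumTo f n                         ∎

sumTo≡sum-range1 : ∀ f N → sumTo f N ≡ sum (map f (range1 N))
sumTo≡sum-range1 f zero    = refl
sumTo≡sum-range1 f (suc N) = sym (begin
  sum (map f (map suc (upTo (suc N))))     ≡⟨ cong (λ l → sum (map f (map suc l))) (sym (upTo-∷ʳ N)) ⟩
  sum (map f (map suc (upTo N ++ [ N ])))  ≡⟨ cong (λ l → sum (map f l)) (map-++ suc (upTo N) [ N ]) ⟩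
  sum (map f (range1 N ++ [ suc N ]))      ≡⟨ cong sum (map-++ f (range1 N) [ suc N ]) ⟩
  sum (map f (range1 N) ++ [ f (suc N) ])  ≡⟨ sum-++ (map f (range1 N)) [ f (suc N) ] ⟩
  sum (map f (range1 N)) + (f (suc N) + 0) ≡⟨ cong₂ _+_ (sym (sumTo≡sum-range1 f N)) (+-identityʳ _) ⟩
  sumTo f N + f (suc N)                    ∎)

when : ∀ {a} {A : Set a} → Dec A → ℕ → ℕ
when (yes _) x = x
when (no _)  _ = 0

when-⇔ : ∀ {A B : Set} (a? : Dec A) (b? : Dec B) x → (A → B) → (B → A) → when a? x ≡ when b? x
when-⇔ (yes _) (yes _)  _ _   _   = refl
when-⇔ (yes a) (no ¬b)  _ a⇒b _   = ⊥-elim (¬b (a⇒b a))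
when-⇔ (no ¬a) (yes b)  _ _   b⇒a = ⊥-elim (¬a (b⇒a b))
when-⇔ (no _)  (no _)   _ _   _   = refl

when-*ˡ : ∀ {A : Set} (a? : Dec A) c x → when a? (c * x) ≡ c * when a? x
when-*ˡ (yes _) c x = refl
when-*ˡ (no _)  c x = sym (*-zeroʳ c)

sum-filter : ∀ {P : ℕ → Set} (P? : ∀ x → Dec (P x)) g xs →
  sum (map g (filter P? xs)) ≡ sum (map (λ x → when (P? x) (g x)) xs)
sum-filter P? g []       = refl
sum-filter P? g (x ∷ xs) with P? x
... | yes _ = cong (g x +_) (sum-filter P? g xs)
... | no _  = sum-filter P? g xs

length≡sum-ones : ∀ (xs : List ℕ) → length xs ≡ sum (map (λ _ → 1) xs)
length≡sum-ones []       = refl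
length≡sum-ones (x ∷ xs) = cong suc (length≡sum-ones xs)

divisorSum : (ℕ → ℕ) → ℕ → ℕ
divisorSum g n = sumTo (λ d → when (d ∣? n) (g d)) n

σ τ : ℕ → ℕ
σ = divisorSum (λ d → d)
τ = divisorSum (λ _ → 1)

divisorSum-beyond : ∀ (g : ℕ → ℕ) n k → .{{NonZero n}} →
  sumTo (λ d → when (d ∣? n) (g d)) (n + k) ≡ divisorSum g n
divisorSum-beyond g n k = sumTo-stable _ n k vanishing
  where
  vanishing : ∀ d → n < d → when (d ∣? n) (g d) ≡ 0
  vanishing d n<d with d ∣? n
  ... | yes d∣n = ⊥-elim (<⇒≱ n<d (∣⇒≤ d∣n))
  ... | no _    = refl

sumTo-multiples : ∀ p (h : ℕ → ℕ) M → .{{NonZero p}} →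
  sumTo (λ d → when (p ∣? d) (h d)) (p * M) ≡ sumTo (λ e → h (p * e)) M
sumTo-multiples p@(suc p-1) h M = reindex M
  where
  F : ℕ → ℕ
  F d = when (p ∣? d) (h d)

  -- no multiple of p lies strictly between pM and pM + p
  gap : ∀ M k → k < p → sumTo F (p * M + k) ≡ sumTo F (p * M)
  gap M zero    _     = cong (sumTo F) (+-identityʳ (p * M))
  gap M (suc k) 1+k<p = begin
    sumTo F (p * M + suc k)                   ≡⟨ cong (sumTo F) (+-suc (p * M) k) ⟩
    sumTo F (p * M + k) + F (suc (p * M + k)) ≡⟨ cong₂ _+_ (gap M k (<-trans (n<1+n k) 1+k<p)) skipped ⟩
    sumTo F (p * M) + 0                       ≡⟨ +-identityʳ _ ⟩
    sumTo F (p * M)                           ∎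
    where
    skipped : F (suc (p * M + k)) ≡ 0
    skipped with p ∣? suc (p * M + k)
    ... | no _  = refl
    ... | yes p∣ = ⊥-elim (<⇒≱ 1+k<p (∣⇒≤ (∣m+n∣m⇒∣n (subst (p ∣_) (sym (+-suc (p * M) k)) p∣) (m∣m*n M))))

  reindex : ∀ M → sumTo F (p * M) ≡ sumTo (λ e → h (p * e)) M
  reindex zero    = cong (sumTo F) (*-zeroʳ p)
  reindex (suc M) = begin
    sumTo F (p * suc M)                            ≡⟨ cong (sumTo F) p[1+M] ⟩
    sumTo F (p * M + p-1) + F (suc (p * M + p-1)) ≡⟨ cong₂ _+_ (gap M p-1 ≤-refl) hit ⟩
    sumTo F (p * M) + h (p * suc M)                ≡⟨ cong (_+ h (p * suc M)) (reindex M) ⟩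
    sumTo (λ e → h (p * e)) M + h (p * suc M)      ∎
    where
    p[1+M] : p * suc M ≡ suc (p * M + p-1)
    p[1+M] = trans (*-suc p M) (cong suc (+-comm p-1 (p * M)))
    hit : F (suc (p * M + p-1)) ≡ h (p * suc M)
    hit with p ∣? suc (p * M + p-1)
    ... | yes _  = cong h (sym p[1+M])
    ... | no p∤ = ⊥-elim (p∤ (subst (p ∣_) p[1+M] (m∣m*n (suc M))))

irreducible-coprime : ∀ {p d} → Irreducible p → ¬ p ∣ d → Coprime d p
irreducible-coprime irr p∤d (i∣d , i∣p) with irr i∣p
... | inj₁ i≡1 = i≡1
... | inj₂ refl = ⊥-elim (p∤d i∣d)

-- For irreducible p ∤ m, a divisor of pm divides m or is a multiple of p, never both.
divisor-split : ∀ (g : ℕ → ℕ) p m → Irreducible p → ¬ p ∣ m → ∀ d →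
  when (d ∣? p * m) (g d) ≡ when (d ∣? m) (g d) + when (p ∣? d) (when (d ∣? p * m) (g d))
divisor-split g p m irr p∤m d with d ∣? m | p ∣? d | d ∣? p * m
... | yes d∣m | yes p∣d | _        = ⊥-elim (p∤m (∣-trans p∣d d∣m))
... | yes _   | no _    | yes _    = sym (+-identityʳ _)
... | yes d∣m | no _    | no d∤pm  = ⊥-elim (d∤pm (∣-trans d∣m (n∣m*n p)))
... | no _    | yes _   | _        = refl
... | no d∤m  | no p∤d  | yes d∣pm = ⊥-elim (d∤m (coprime-divisor (irreducible-coprime irr p∤d) d∣pm))
... | no _    | no _    | no _     = refl

divisorSum-prime : ∀ (g : ℕ → ℕ) p m → Irreducible p → ¬ p ∣ m → .{{NonZero m}} →
  divisorSum g (p * m) ≡ divisorSum g m + divisorSum (λ e → g (p * e)) m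
divisorSum-prime g zero        m irr _   = ⊥-elim (¬irreducible[0] irr)
divisorSum-prime g p@(suc p-1) m irr p∤m = begin
  sumTo (λ d → when (d ∣? p * m) (g d)) (p * m)
    ≡⟨ sumTo-cong (λ d → divisor-split g p m irr p∤m (suc d)) (p * m) ⟩
  sumTo (λ d → when (d ∣? m) (g d) + multiple d) (p * m)
    ≡⟨ sumTo-+ _ multiple (p * m) ⟩
  sumTo (λ d → when (d ∣? m) (g d)) (p * m) + sumTo multiple (p * m)
    ≡⟨ cong₂ _+_ (divisorSum-beyond g m (p-1 * m)) (sumTo-multiples p _ m) ⟩
  divisorSum g m + sumTo (λ e → when (p * e ∣? p * m) (g (p * e))) m
    ≡⟨ cong (divisorSum g m +_) (sumTo-cong cancel-p m) ⟩
  divisorSum g m + divisorSum (λ e → g (p * e)) m ∎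
  where
  multiple : ℕ → ℕ
  multiple d = when (p ∣? d) (when (d ∣? p * m) (g d))
  cancel-p : ∀ e → when (p * suc e ∣? p * m) (g (p * suc e)) ≡ when (suc e ∣? m) (g (p * suc e))
  cancel-p e = when-⇔ (p * suc e ∣? p * m) (suc e ∣? m) _ (*-cancelˡ-∣ p) (*-monoʳ-∣ p)

σ-prime : ∀ p m → Irreducible p → ¬ p ∣ m → .{{NonZero m}} → σ (p * m) ≡ suc p * σ m
σ-prime p m irr p∤m = begin
  σ (p * m)                        ≡⟨ divisorSum-prime (λ d → d) p m irr p∤m ⟩
  σ m + divisorSum (λ e → p * e) m ≡⟨ cong (σ m +_) (sumTo-cong (λ e → when-*ˡ (suc e ∣? m) p (suc e)) m) ⟩
  σ m + sumTo (λ e → p * when (e ∣? m) e) m ≡⟨ cong (σ m +_) (sumTo-*ˡ p _ m) ⟩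
  σ m + p * σ m                    ∎

τ-prime : ∀ p m → Irreducible p → ¬ p ∣ m → .{{NonZero m}} → τ (p * m) ≡ 2 * τ m
τ-prime p m irr p∤m =
  trans (divisorSum-prime (λ _ → 1) p m irr p∤m) (cong (τ m +_) (sym (+-identityʳ (τ m))))

squarefree-coprime : ∀ {n} d e → Squarefree n → d * e ≡ n → gcd d e ≡ 1
squarefree-coprime d e sq de≡n =
  sq (gcd d e) (subst (gcd d e * gcd d e ∣_) de≡n (*-pres-∣ (gcd[m,n]∣m d e) (gcd[m,n]∣n d e)))

maxList-lub : ∀ {b} xs → All (_≤ b) xs → maxList xs ≤ b
maxList-lub []       []         = z≤n
maxList-lub (x ∷ xs) (x≤b ∷ ps) = ⊔-lub x≤b (maxList-lub xs ps)

maxList-ub : ∀ {x} xs → x ∈ xs → x ≤ maxList xs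
maxList-ub (y ∷ xs) (here refl) = m≤m⊔n y (maxList xs)
maxList-ub (y ∷ xs) (there x∈) = ≤-trans (maxList-ub xs x∈) (m≤n⊔m y (maxList xs))

-- A common unitary divisor divides the gcd, so coprime numbers have gcud 1.
gcud-coprime : ∀ a b → .{{NonZero a}} → gcd a b ≡ 1 → gcud a b ≡ 1
gcud-coprime a@(suc _) b gcd≡1 = ≤-antisym
  (maxList-lub _ (All.map at-most-1 (all-filter C? (range1 a))))
  (maxList-ub _ (∈-filter⁺ C? (here refl) ((1∣ a , gcd-zeroˡ (quot a 1)) , (1∣ b , gcd-zeroˡ (quot b 1)))))
  where
  C? : ∀ x → Dec (IsUnitaryDivisor x a × IsUnitaryDivisor x b)
  C? x = isUnitaryDivisor? x a ×-dec isUnitaryDivisor? x b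
  at-most-1 : ∀ {x} → IsUnitaryDivisor x a × IsUnitaryDivisor x b → x ≤ 1
  at-most-1 ((x∣a , _) , (x∣b , _)) = ≤-reflexive (∣1⇒≡1 (subst (_ ∣_) gcd≡1 (gcd-greatest x∣a x∣b)))

biUnitary-squarefree : ∀ {n d} → Squarefree n → .{{NonZero d}} → d ∣ n → IsBiUnitaryDivisor d n
biUnitary-squarefree {n} {d@(suc _)} sq d∣n@(divides e n≡ed) =
  d∣n , gcud-coprime d (quot n d) (trans (cong (gcd d) n/d≡e) (squarefree-coprime d e sq (trans (*-comm d e) (sym n≡ed))))
  where
  n/d≡e : quot n d ≡ e
  n/d≡e = trans (cong (_/ d) n≡ed) (m*n/n≡m e d)

biUnitarySum-squarefree : ∀ (g : ℕ → ℕ) n → Squarefree n → sum (map g (biUnitaryDivisors n)) ≡ divisorSum g n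
biUnitarySum-squarefree g n sq = begin
  sum (map g (filter BU? (range1 n)))             ≡⟨ sum-filter BU? g (range1 n) ⟩
  sum (map (λ d → when (BU? d) (g d)) (range1 n)) ≡⟨ sym (sumTo≡sum-range1 _ n) ⟩
  sumTo (λ d → when (BU? d) (g d)) n              ≡⟨ sumTo-cong all-divisors n ⟩
  divisorSum g n                                  ∎
  where
  BU? : ∀ d → Dec (IsBiUnitaryDivisor d n)
  BU? d = isBiUnitaryDivisor? d n
  all-divisors : ∀ d → when (BU? (suc d)) (g (suc d)) ≡ when (suc d ∣? n) (g (suc d))
  all-divisors d = when-⇔ (BU? (suc d)) (suc d ∣? n) _ proj₁ (biUnitary-squarefree sq)

σ**-squarefree : ∀ {n} → Squarefree n → σ** n ≡ σ n
σ**-squarefree {n} sq = trans (cong sum (sym (map-id (biUnitaryDivisors n)))) (biUnitarySum-squarefree (λ d → d) n sq)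

d**-squarefree : ∀ {n} → Squarefree n → d** n ≡ τ n
d**-squarefree {n} sq = trans (length≡sum-ones (biUnitaryDivisors n)) (biUnitarySum-squarefree (λ _ → 1) n sq)

record LeastFactor (q n : ℕ) : Set where
  field
    q≥2   : q ≥ 2
    q∣n   : q ∣ n
    least : ∀ {d} → d ≥ 2 → d ∣ n → q ≤ d

-- Search upwards from 2, keeping track that nothing below divides n;
-- the search stops at the latest at n itself.
leastFactor : ∀ n → n ≥ 2 → ∃ λ q → LeastFactor q n
leastFactor n n≥2 = search 2 (n ∸ 2) (m+[n∸m]≡n n≥2) ≤-refl (λ d≥2 d<2 _ → <⇒≱ d<2 d≥2)
  where
  search : ∀ j c → j + c ≡ n → j ≥ 2 → (∀ {d} → d ≥ 2 → d < j → ¬ d ∣ n) → ∃ λ q → LeastFactor q n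
  search j c j+c≡n j≥2 none-below with j ∣? n
  ... | yes j∣n = j , record
    { q≥2 = j≥2 ; q∣n = j∣n ; least = λ d≥2 d∣n → ≮⇒≥ (λ d<j → none-below d≥2 d<j d∣n) }
  search j zero    j+0≡n _   _          | no j∤n =
    ⊥-elim (j∤n (subst (j ∣_) (trans (sym (+-identityʳ j)) j+0≡n) ∣-refl))
  search j (suc c) j+c≡n j≥2 none-below | no j∤n =
    search (suc j) c (trans (sym (+-suc j c)) j+c≡n) (m≤n⇒m≤1+n j≥2) none-up-to-j
    where
    none-up-to-j : ∀ {d} → d ≥ 2 → d < suc j → ¬ d ∣ n
    none-up-to-j d≥2 d<1+j with m<1+n⇒m<n∨m≡n d<1+j
    ... | inj₁ d<j  = none-below d≥2 d<j
    ... | inj₂ refl = j∤n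

leastFactor-irreducible : ∀ {q n} → LeastFactor q n → Irreducible q
leastFactor-irreducible lf {zero} 0∣q with 0∣⇒≡0 0∣q
... | refl with LeastFactor.q≥2 lf
...   | ()
leastFactor-irreducible lf {suc zero}    _   = inj₁ refl
leastFactor-irreducible lf {suc (suc i)} i∣q =
  inj₂ (≤-antisym (∣⇒≤ {{>-nonZero (≤-trans (s≤s z≤n) q≥2)}} i∣q) (least (s≤s (s≤s z≤n)) (∣-trans i∣q q∣n)))
  where open LeastFactor lf

squarefree-∣ : ∀ {d n} → Squarefree n → d ∣ n → Squarefree d
squarefree-∣ sq d∣n m m²∣d = sq m (∣-trans m²∣d d∣n)

record Split (n : ℕ) : Set where
  field
    q m            : ℕ
    n≡q*m          : n ≡ q * m
    least          : LeastFactor q (q * m)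
    q∤m            : ¬ q ∣ m
    m-nonZero      : NonZero m
    m-squarefree   : Squarefree m
    m<n            : m < n

split : ∀ {n} → n ≥ 2 → Squarefree n → Split n
split {n} n≥2 sq with leastFactor n n≥2
... | q , lf with LeastFactor.q∣n lf
... | divides m n≡mq = record
  { q = q ; m = m ; n≡q*m = n≡qm ; least = subst (LeastFactor q) n≡qm lf
  ; q∤m = q∤m ; m-nonZero = m-nonZero ; m-squarefree = squarefree-∣ sq (divides q n≡qm) ; m<n = m<n }
  where
  instance
    m-nonZero : NonZero m
    m-nonZero = ≢-nonZero m≢0
      where
      m≢0 : m ≢ 0
      m≢0 refl with subst (_≥ 2) n≡mq n≥2
      ... | ()
  n≡qm : n ≡ q * m
  n≡qm = trans n≡mq (*-comm m q)
  q∤m : ¬ q ∣ m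
  q∤m q∣m = <⇒≱ (LeastFactor.q≥2 lf)
    (≤-reflexive (sq q (subst (q * q ∣_) (sym n≡qm) (*-monoʳ-∣ q q∣m))))
  m<n : m < n
  m<n = subst (m <_) (sym n≡mq) (m<m*n m q (LeastFactor.q≥2 lf))

squarefree-induction : (P : ℕ → Set) → P 1 →
  (∀ {q m} → LeastFactor q (q * m) → ¬ q ∣ m → .{{NonZero m}} → Squarefree m → P m → P (q * m)) →
  ∀ n → .{{NonZero n}} → Squarefree n → P n
squarefree-induction P base step = <-rec (λ n → .{{NonZero n}} → Squarefree n → P n) go
  where
  go : ∀ n → (∀ {k} → k < n → .{{NonZero k}} → Squarefree k → P k) → .{{NonZero n}} → Squarefree n → P n
  go (suc zero)    _  _  = base
  go (suc (suc k)) ih sq = subst P (sym n≡q*m) (step least q∤m {{m-nonZero}} m-squarefree (ih m<n {{m-nonZero}} m-squarefree))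
    where open Split (split (s≤s (s≤s z≤n)) sq)

even-or-odd : ∀ x → 2 ∣ x ⊎ 2 ∣ suc x
even-or-odd zero    = inj₁ (divides 0 refl)
even-or-odd (suc x) with even-or-odd x
... | inj₁ (divides k x≡2k) = inj₂ (divides (suc k) (cong (λ y → suc (suc y)) x≡2k))
... | inj₂ 2∣1+x            = inj₁ 2∣1+x

odd⇒2∣suc : ∀ {x} → ¬ 2 ∣ x → 2 ∣ suc x
odd⇒2∣suc {x} x-odd with even-or-odd x
... | inj₁ 2∣x   = ⊥-elim (x-odd 2∣x)
... | inj₂ 2∣1+x = 2∣1+x

τ-nonZero : ∀ n → .{{NonZero n}} → Squarefree n → NonZero (τ n)
τ-nonZero n sq = >-nonZero (squarefree-induction (λ k → τ k ≥ 1) (s≤s z≤n) step n sq)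
  where
  step : ∀ {q m} → LeastFactor q (q * m) → ¬ q ∣ m → .{{NonZero m}} → Squarefree m → τ m ≥ 1 → τ (q * m) ≥ 1
  step {q} {m} lf q∤m _ τm≥1 = subst (_≥ 1) (sym (τ-prime q m (leastFactor-irreducible lf) q∤m))
    (≤-trans τm≥1 (m≤m+n (τ m) (τ m + 0)))

-- For odd squarefree n each factor p+1 of σ(n) is even, so τ(n) ∣ σ(n).
τ∣σ-odd : ∀ n → .{{NonZero n}} → Squarefree n → ¬ 2 ∣ n → τ n ∣ σ n
τ∣σ-odd = squarefree-induction (λ n → ¬ 2 ∣ n → τ n ∣ σ n) (λ _ → ∣-refl) step
  where
  step : ∀ {q m} → LeastFactor q (q * m) → ¬ q ∣ m → .{{NonZero m}} → Squarefree m →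
    (¬ 2 ∣ m → τ m ∣ σ m) → ¬ 2 ∣ q * m → τ (q * m) ∣ σ (q * m)
  step {q} {m} lf q∤m _ ih qm-odd = subst₂ _∣_ (sym (τ-prime q m irr q∤m)) (sym (σ-prime q m irr q∤m))
    (*-pres-∣ (odd⇒2∣suc {q} (λ 2∣q → qm-odd (∣-trans 2∣q (m∣m*n m))))
              (ih (λ 2∣m → qm-odd (∣-trans 2∣m (n∣m*n q)))))
    where
    irr : Irreducible q
    irr = leastFactor-irreducible lf

cancel-σ-τ : ∀ a b m → .{{NonZero m}} → Squarefree m → ¬ 2 ∣ m → a * σ m ∣ b * τ m → a ∣ b
cancel-σ-τ a b m sq m-odd aσ∣bτ =
  *-cancelʳ-∣ (τ m) {{τ-nonZero m sq}} (∣-trans (*-monoʳ-∣ a (τ∣σ-odd m sq m-odd)) aσ∣bτ)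

harmonic-step : ∀ {q m} N → Irreducible q → ¬ q ∣ m → .{{NonZero m}} → Squarefree m → ¬ 2 ∣ m →
  σ (q * m) ∣ N * τ (q * m) → suc q ∣ 2 * N
harmonic-step {q} {m} N irr q∤m sq m-odd σ∣Nτ = cancel-σ-τ (suc q) (2 * N) m sq m-odd
  (subst₂ _∣_ (σ-prime q m irr q∤m) (trans (cong (N *_) (τ-prime q m irr q∤m)) N[2t]≡2Nt) σ∣Nτ)
  where
  N[2t]≡2Nt : N * (2 * τ m) ≡ 2 * N * τ m
  N[2t]≡2Nt = trans (sym (*-assoc N 2 (τ m))) (cong (_* τ m) (*-comm N 2))

irreducible[3] : Irreducible 3
irreducible[3] = from-yes (irreducible? 3)

coprime[2,3] : Coprime 2 3
coprime[2,3] = irreducible-coprime irreducible[3] (from-no (3 ∣? 2))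

coprime[3,2] : Coprime 3 2
coprime[3,2] = irreducible-coprime irreducible[2] (from-no (2 ∣? 3))

odd-∣-double : ∀ {t N} → ¬ 2 ∣ t → t ∣ 2 * N → t ∣ N
odd-∣-double t-odd = coprime-divisor (irreducible-coprime irreducible[2] t-odd)

half-bounds : ∀ {q t} → q ≥ 2 → suc q ≡ t * 2 → t ≥ 2 × t < q
half-bounds {t = zero}         _             ()
half-bounds {t = suc zero}     (s≤s (s≤s _)) ()
half-bounds {t = suc (suc t')} _             refl = s≤s (s≤s z≤n) , s≤s (s≤s (s≤s (m≤m*n t' 2)))

quarter-bounds : ∀ {q u} → q ≥ 2 → q ≢ 3 → suc q ≡ u * 2 * 2 → u ≥ 2 × u < q
quarter-bounds {u = zero}         _ _   ()
quarter-bounds {u = suc zero}     _ q≢3 refl = ⊥-elim (q≢3 refl)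
quarter-bounds {u = suc (suc u')} _ _   refl = s≤s (s≤s z≤n) ,
  s≤s (s≤s (s≤s (≤-trans (m≤m*n u' 2) (≤-trans (m≤m*n (u' * 2) 2) (m≤n+m (u' * 2 * 2) 4)))))

half-successor : ∀ {q N t} → LeastFactor q N → suc q ≡ t * 2 → ¬ t ∣ N
half-successor lf 1+q≡2t t∣N with half-bounds (LeastFactor.q≥2 lf) 1+q≡2t
... | t≥2 , t<q = <⇒≱ t<q (LeastFactor.least lf t≥2 t∣N)

-- If the least factor q of N is odd and q ≠ 3, then q+1 does not divide 4N:
-- (q+1)/4 or (q+1)/2 would be a divisor of N in [2, q).
quarter-successor : ∀ {q N} → LeastFactor q N → q ≢ 3 → ¬ 2 ∣ q → ¬ suc q ∣ 2 * (2 * N)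
quarter-successor {q} {N} lf q≢3 q-odd 1+q∣4N with odd⇒2∣suc q-odd
... | divides t 1+q≡2t with 2 ∣? t
...   | yes (divides u t≡2u) with quarter-bounds (LeastFactor.q≥2 lf) q≢3 (trans 1+q≡2t (cong (_* 2) t≡2u))
...     | u≥2 , u<q = <⇒≱ u<q (LeastFactor.least lf u≥2 u∣N)
  where
  u∣N : u ∣ N
  u∣N = *-cancelʳ-∣ 2 (subst (_∣ N * 2) t≡2u (*-cancelʳ-∣ 2 (subst₂ _∣_ 1+q≡2t 4N≡2N*2 1+q∣4N)))
    where
    4N≡2N*2 : 2 * (2 * N) ≡ N * 2 * 2
    4N≡2N*2 = trans (*-comm 2 (2 * N)) (cong (_* 2) (*-comm 2 N))
quarter-successor {q} {N} lf q≢3 q-odd 1+q∣4N | divides t 1+q≡2t | no t-odd =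
  half-successor lf 1+q≡2t (odd-∣-double t-odd (*-cancelʳ-∣ 2 (subst₂ _∣_ 1+q≡2t (*-comm 2 (2 * N)) 1+q∣4N)))

-- An odd squarefree number qm > 1 (q its least factor) is not harmonic:
-- (q+1)/2 would divide qm.
odd-not-harmonic : ∀ {q m} → LeastFactor q (q * m) → ¬ q ∣ m → .{{NonZero m}} → Squarefree m →
  ¬ 2 ∣ q * m → ¬ σ (q * m) ∣ (q * m) * τ (q * m)
odd-not-harmonic {q} {m} lf q∤m sq qm-odd harmonic with odd⇒2∣suc {q} (λ 2∣q → qm-odd (∣-trans 2∣q (m∣m*n m)))
... | divides t 1+q≡2t = half-successor {t = t} lf 1+q≡2t
  (*-cancelʳ-∣ 2 (subst₂ _∣_ 1+q≡2t (*-comm 2 (q * m)) 1+q∣2qm))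
  where
  1+q∣2qm : suc q ∣ 2 * (q * m)
  1+q∣2qm = harmonic-step (q * m) (leastFactor-irreducible lf) q∤m sq
    (λ 2∣m → qm-odd (∣-trans 2∣m (n∣m*n q))) harmonic

descend-6 : ∀ m → .{{NonZero m}} → ¬ 2 ∣ m → ¬ 3 ∣ m →
  σ (2 * (3 * m)) ∣ 2 * (3 * m) * τ (2 * (3 * m)) → σ m ∣ 2 * m * τ m
descend-6 m m-odd 3∤m harmonic = *-cancelˡ-∣ 12 (subst₂ _∣_ σ[6m] 6m·τ[6m] harmonic)
  where
  instance
    3m-nonZero : NonZero (3 * m)
    3m-nonZero = m*n≢0 3 m
  3m-odd : ¬ 2 ∣ 3 * m
  3m-odd 2∣3m = m-odd (coprime-divisor coprime[2,3] 2∣3m)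
  σ[6m] : σ (2 * (3 * m)) ≡ 12 * σ m
  σ[6m] = begin
    σ (2 * (3 * m)) ≡⟨ σ-prime 2 (3 * m) irreducible[2] 3m-odd ⟩
    3 * σ (3 * m)   ≡⟨ cong (3 *_) (σ-prime 3 m irreducible[3] 3∤m) ⟩
    3 * (4 * σ m)   ≡⟨ sym (*-assoc 3 4 (σ m)) ⟩
    12 * σ m        ∎
  6m·τ[6m] : 2 * (3 * m) * τ (2 * (3 * m)) ≡ 12 * (2 * m * τ m)
  6m·τ[6m] = begin
    2 * (3 * m) * τ (2 * (3 * m)) ≡⟨ cong (2 * (3 * m) *_) (τ-prime 2 (3 * m) irreducible[2] 3m-odd) ⟩
    2 * (3 * m) * (2 * τ (3 * m)) ≡⟨ cong (λ x → 2 * (3 * m) * (2 * x)) (τ-prime 3 m irreducible[3] 3∤m) ⟩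
    2 * (3 * m) * (2 * (2 * τ m)) ≡⟨ rearrange m (τ m) ⟩
    12 * (2 * m * τ m)            ∎
    where
    rearrange : ∀ x y → 2 * (3 * x) * (2 * (2 * y)) ≡ 12 * (2 * x * y)
    rearrange = solve 2 (λ x y → (con 2 :* (con 3 :* x)) :* (con 2 :* (con 2 :* y))
                                 := con 12 :* ((con 2 :* x) :* y)) refl

-- For squarefree m coprime to 6, σ(m) ∣ 2m·τ(m) forces m = 1: otherwise its
-- least factor q ≥ 5 would give (q+1) ∣ 4m.
double-harmonic : ∀ m → .{{NonZero m}} → Squarefree m → ¬ 2 ∣ m → ¬ 3 ∣ m →
  σ m ∣ 2 * m * τ m → m ≡ 1
double-harmonic (suc zero)    _  _     _   _        = refl
double-harmonic (suc (suc k)) sq m-odd 3∤m harmonic = ⊥-elim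
  (quarter-successor least (λ q≡3 → 3∤m (subst (_∣ suc (suc k)) q≡3 q∣n)) (λ 2∣q → m-odd (∣-trans 2∣q q∣n))
    (harmonic-step {q} {m} (2 * (q * m)) (leastFactor-irreducible least) q∤m {{m-nonZero}} m-squarefree
      (λ 2∣m → m-odd (subst (2 ∣_) (sym n≡q*m) (∣-trans 2∣m (n∣m*n q))))
      (subst (λ x → σ x ∣ 2 * x * τ x) n≡q*m harmonic)))
  where
  open Split (split (s≤s (s≤s z≤n)) sq)
  q∣n : q ∣ suc (suc k)
  q∣n = subst (q ∣_) (sym n≡q*m) (m∣m*n m)

-- 2m (m odd squarefree) is harmonic only for m = 3: first 3 ∣ m, then m = 3m'
-- with m' = 1 by the descent to σ(m') ∣ 2m'·τ(m').
even-harmonic : ∀ m → .{{NonZero m}} → Squarefree m → ¬ 2 ∣ m →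
  σ (2 * m) ∣ (2 * m) * τ (2 * m) → 2 * m ≡ 6
even-harmonic m sq m-odd harmonic with coprime-divisor coprime[3,2] (coprime-divisor coprime[3,2]
                                       (harmonic-step (2 * m) irreducible[2] m-odd sq m-odd harmonic))
... | divides m' m≡m'*3 = begin
  2 * m        ≡⟨ cong (2 *_) m≡3m' ⟩
  2 * (3 * m') ≡⟨ cong (λ x → 2 * (3 * x)) m'≡1 ⟩
  6            ∎
  where
  m≡3m' : m ≡ 3 * m'
  m≡3m' = trans m≡m'*3 (*-comm m' 3)
  instance
    m'-nonZero : NonZero m'
    m'-nonZero = ≢-nonZero (λ m'≡0 → ≢-nonZero⁻¹ m (trans m≡3m' (cong (3 *_) m'≡0)))
  m'∣m : m' ∣ m
  m'∣m = divides 3 m≡3m'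
  m'-odd : ¬ 2 ∣ m'
  m'-odd 2∣m' = m-odd (∣-trans 2∣m' m'∣m)
  3∤m' : ¬ 3 ∣ m'
  3∤m' 3∣m' with sq 3 (subst (3 * 3 ∣_) (sym m≡3m') (*-monoʳ-∣ 3 3∣m'))
  ... | ()
  m'≡1 : m' ≡ 1
  m'≡1 = double-harmonic m' (squarefree-∣ sq m'∣m) m'-odd 3∤m'
    (descend-6 m' m'-odd 3∤m' (subst (λ x → σ (2 * x) ∣ 2 * x * τ (2 * x)) m≡3m' harmonic))

harmonic-by-least-factor : ∀ {q m} → LeastFactor q (q * m) → ¬ q ∣ m → .{{NonZero m}} → Squarefree m →
  σ (q * m) ∣ (q * m) * τ (q * m) → q * m ≡ 6
harmonic-by-least-factor {q} {m} lf q∤m sq harmonic with q ≟ 2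
... | yes refl = even-harmonic m sq q∤m harmonic
... | no q≢2   = ⊥-elim (odd-not-harmonic lf q∤m sq qm-odd harmonic)
  where
  qm-odd : ¬ 2 ∣ q * m
  qm-odd 2∣qm = q≢2 (≤-antisym (LeastFactor.least lf ≤-refl 2∣qm) (LeastFactor.q≥2 lf))

squarefree-harmonic : ∀ n → .{{NonZero n}} → Squarefree n → σ n ∣ n * τ n → n ≡ 1 ⊎ n ≡ 6
squarefree-harmonic (suc zero)    _  _        = inj₁ refl
squarefree-harmonic (suc (suc k)) sq harmonic =
  inj₂ (trans n≡q*m (harmonic-by-least-factor least q∤m {{m-nonZero}} m-squarefree
    (subst (λ x → σ x ∣ x * τ x) n≡q*m harmonic)))
  where open Split (split (s≤s (s≤s z≤n)) sq)

mainTheorem4 : ∀ (n : ℕ) → 1 ≤ n → Squarefree n →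
    (BiUnitaryHarmonic n ⇔ (n ≡ 1 ⊎ n ≡ 6))
mainTheorem4 n n≥1 sq = mk⇔ classify realise
  where
  instance
    n-nonZero : NonZero n
    n-nonZero = >-nonZero n≥1
  classify : BiUnitaryHarmonic n → n ≡ 1 ⊎ n ≡ 6
  classify harmonic = squarefree-harmonic n sq
    (subst₂ (λ s t → s ∣ n * t) (σ**-squarefree sq) (d**-squarefree sq) harmonic)
  -- σ**(1) = 1 ∣ 1 and σ**(6) = 12 ∣ 6·d**(6) = 24
  realise : n ≡ 1 ⊎ n ≡ 6 → BiUnitaryHarmonic n
  realise (inj₁ refl) = divides 1 refl
  realise (inj₂ refl) = divides 2 refl
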